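{- Every strongly interference-free morphism is recognizable.
   Context: Morphisms $\phi:\Sigma^*\to\Gamma^*$ with images $\phi(c)$, $c\in\Sigma$; injective means $\phi(u)\ne\phi(v)$ for $u\neq v$. A word admits an image factorization if it is a concatenation of zero or more images. A word $w$ admits an interfered image factorization if $w=xyz$ with $x$ a proper (possibly empty) suffix of some image, $y$ admitting an image factorization, $z$ a proper (possibly empty) prefix of some image, and $xz\neq\varepsilon$. A word is an inner image factor if it is a proper factor of some image $\phi(c)$ that is neither a prefix nor a suffix of $\phi(c)$. An injective $\phi$ is strongly interference-free if for every non-empty $u\in\Sigma^*$, $\phi(u)$ admits no interfered image factorization and is not an inner image factor. A rotation of $w$ is $w[i..|w|]\,w[1..i-1]$ for some $1\le i\le |w|$. A word $w$ admits a circular image factorization if $w=qrp$ with $r$ admitting an image factorization, $pq=\phi(c)$ for some $c\in\Sigma$, and $p\ne\varepsilon$. An injective $\phi$ is recognizable if for every non-empty $u\in\Sigma^*$ and every rotation $w'$ of $\phi(u)$, $w'$ admits a unique circular image factorization. -}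

module Defs where

open import Data.Nat using (ℕ; _≤_; _∸_)
open import Data.Fin using (Fin)
open import Data.List using (List; []; _++_; concatMap; take; drop; length)
open import Data.Product using (Σ; ∃; ∃-syntax; _×_; _,_)
open import Relation.Nullary using (¬_)
open import Relation.Binary.PropositionalEquality using (_≡_; _≢_)

Morphism : ℕ → ℕ → Set
Morphism m k = Fin m → List (Fin k)

module _ {m k : ℕ} (φ : Morphism m k) where

  ext : List (Fin m) → List (Fin k)
  ext = concatMap φ

  Injective : Set
  Injective = ∀ (u v : List (Fin m)) → ext u ≡ ext v → u ≡ v

  HasImageFactorization : List (Fin k) → Set
  HasImageFactorization w = ∃[ u ] ext u ≡ w

  ProperSuffixOfImage : List (Fin k) → Set
  ProperSuffixOfImage x = ∃[ c ] ∃[ s ] (s ≢ [] × s ++ x ≡ φ c)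

  ProperPrefixOfImage : List (Fin k) → Set
  ProperPrefixOfImage z = ∃[ c ] ∃[ s ] (s ≢ [] × z ++ s ≡ φ c)

  HasInterferedImageFactorization : List (Fin k) → Set
  HasInterferedImageFactorization w =
    ∃[ x ] ∃[ y ] ∃[ z ]
      ( w ≡ x ++ y ++ z
      × ProperSuffixOfImage x
      × HasImageFactorization y
      × ProperPrefixOfImage z
      × x ++ z ≢ [] )

  IsInnerImageFactor : List (Fin k) → Set
  IsInnerImageFactor w =
    ∃[ c ] ( (∃[ a ] ∃[ b ] (a ++ w ++ b ≡ φ c))
           × w ≢ φ c
           × ¬ (∃[ s ] (w ++ s ≡ φ c))
           × ¬ (∃[ p ] (p ++ w ≡ φ c)) )

  StronglyInterferenceFree : Set
  StronglyInterferenceFree =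
    Injective ×
    (∀ (u : List (Fin m)) → u ≢ [] →
        ¬ HasInterferedImageFactorization (ext u) × ¬ IsInnerImageFactor (ext u))

  record CircularImageFactorization (w : List (Fin k)) : Set where
    field
      q r p   : List (Fin k)
      split   : w ≡ q ++ r ++ p
      factor  : HasImageFactorization r
      image   : ∃[ c ] (p ++ q ≡ φ c)
      nonempty : p ≢ []

  open CircularImageFactorization

  HasUniqueCircularImageFactorization : List (Fin k) → Set
  HasUniqueCircularImageFactorization w =
    CircularImageFactorization w ×
    (∀ (f g : CircularImageFactorization w) →
        q f ≡ q g × r f ≡ r g × p f ≡ p g)

  Recognizable : Set
  Recognizable =
    Injective ×
    (∀ (u : List (Fin m)) → u ≢ [] → ∀ (w' : List (Fin k)) →
        IsRotation w' (ext u) → HasUniqueCircularImageFactorization w')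
    where
    -- w' = w[i..|w|] w[1..i-1] for some 1 ≤ i ≤ |w|
    IsRotation : List (Fin k) → List (Fin k) → Set
    IsRotation w' w = ∃[ i ] (1 ≤ i × i ≤ length w × w' ≡ drop (i ∸ 1) w ++ take (i ∸ 1) w)

-- Call x φ*(w) z, with x a proper suffix and z a proper prefix of images,
-- interfered unless x = z = ε.  Strong interference-freeness says no image φ c
-- is interfered, and injectivity then makes images rigid: φ c = φ*(w) only for
-- w = c.  If q₁ r₁ p₁ and (q₁ d) r₂ p₂ are circular factorizations of the same
-- word, cutting d at image boundaries writes φ c₂ = p₂ q₁ d in this shape, so
-- rigidity forces d = ε and p₁ = p₂, whence r₁ = r₂.  Existence: the rotation
-- point of φ(u) falls inside some image, which is split as p q around it.
module Submission where

open import Defs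
open import Data.Nat using (ℕ; zero; suc; _<_; s≤s)
open import Data.Fin using (Fin)
open import Data.List using (List; []; _∷_; _++_; [_]; take; drop; length; initLast; _∷ʳ′_)
open import Data.List.Properties
  using (++-assoc; ++-identityʳ; ++-cancelʳ; ++-conicalˡ; ++-conicalʳ; ∷-injective; concatMap-++; take++drop≡id; ++-monoid)
open import Data.Product using (∃-syntax; _×_; _,_; proj₁; proj₂)
open import Data.Sum using (_⊎_; inj₁; inj₂)
open import Data.Empty using (⊥-elim)
open import Relation.Nullary using (¬_)
open import Relation.Binary.PropositionalEquality
  using (_≡_; _≢_; refl; sym; trans; cong; cong₂; subst; module ≡-Reasoning)
open import Tactic.MonoidSolver using (solve)

module _ {A : Set} where

  ++-≡-++-split : ∀ (a b c d : List A) → a ++ b ≡ c ++ d →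
    (∃[ e ] (a ≡ c ++ e × d ≡ e ++ b)) ⊎ (∃[ e ] (e ≢ [] × c ≡ a ++ e × b ≡ e ++ d))
  ++-≡-++-split []      b []      d eq = inj₁ ([] , refl , sym eq)
  ++-≡-++-split []      b (y ∷ c) d eq = inj₂ (y ∷ c , (λ ()) , refl , eq)
  ++-≡-++-split (x ∷ a) b []      d eq = inj₁ (x ∷ a , refl , sym eq)
  ++-≡-++-split (x ∷ a) b (y ∷ c) d eq with ∷-injective eq
  ... | refl , eq′ with ++-≡-++-split a b c d eq′
  ... | inj₁ (e , a≡ , d≡)        = inj₁ (e , cong (x ∷_) a≡ , d≡)
  ... | inj₂ (e , e≢[] , c≡ , b≡) = inj₂ (e , e≢[] , cong (x ∷_) c≡ , b≡)

  ++-∷-≡-[-] : ∀ (xs : List A) {y ys z} → xs ++ y ∷ ys ≡ [ z ] → xs ≡ [] × ys ≡ []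
  ++-∷-≡-[-] []       eq = refl , proj₂ (∷-injective eq)
  ++-∷-≡-[-] (x ∷ xs) {y} {ys} eq with ++-conicalʳ xs (y ∷ ys) (proj₂ (∷-injective eq))
  ... | ()

  drop-≢[] : ∀ n (xs : List A) → n < length xs → drop n xs ≢ []
  drop-≢[] zero    (x ∷ xs) _         ()
  drop-≢[] (suc n) (x ∷ xs) (s≤s n<) = drop-≢[] n xs n<

module _ {m k : ℕ} (φ : Morphism m k) where
  open CircularImageFactorization
  open ≡-Reasoning

  private
    φ* : List (Fin m) → List (Fin k)
    φ* = ext φ

    Circular : List (Fin k) → Set
    Circular = CircularImageFactorization φ

  -- The boundary between d and s lies in d s = φ* (v₁ ++ c ∷ v₂), inside the
  -- occurrence of φ c = a b and strictly before its end.
  record CutInImage (d s : List (Fin k)) : Set where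
    constructor cut
    field
      v₁ v₂    : List (Fin m)
      c        : Fin m
      a b      : List (Fin k)
      a++b≡φc  : a ++ b ≡ φ c
      b≢[]     : b ≢ []
      d≡       : d ≡ φ* v₁ ++ a
      s≡       : s ≡ b ++ φ* v₂

  ext-cut : ∀ d s t → d ++ s ≡ φ* t → s ≢ [] → CutInImage d s
  ext-cut d s []      eq s≢[] = ⊥-elim (s≢[] (++-conicalʳ d s eq))
  ext-cut d s (c ∷ t) eq s≢[] with ++-≡-++-split d s (φ c) (φ* t) eq
  ... | inj₂ (b , b≢[] , φc≡ , s≡) = cut [] t c d b (sym φc≡) b≢[] refl s≡
  ... | inj₁ (e , refl , e++s≡) with ext-cut e s t (sym e++s≡) s≢[]
  ... | cut v₁ v₂ c′ a b a++b≡ b≢[] refl s≡ =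
        cut (c ∷ v₁) v₂ c′ a b a++b≡ b≢[] (sym (++-assoc (φ c) (φ* v₁) a)) s≡

  injective⇒nonerasing : Injective φ → ∀ c → φ c ≢ []
  injective⇒nonerasing inj c φc≡[] with inj [ c ] [] (trans (++-identityʳ (φ c)) φc≡[])
  ... | ()

  module _ (φ≢[] : ∀ c → φ c ≢ []) where

    []-properSuffix : Fin m → ProperSuffixOfImage φ []
    []-properSuffix c = c , φ c , φ≢[] c , ++-identityʳ (φ c)

    suffix-of-ext : Fin m → ∀ s e t → s ++ e ≡ φ* t →
                    ∃[ x ] ∃[ w ] (e ≡ x ++ φ* w × ProperSuffixOfImage φ x)
    suffix-of-ext c₀ []      e t       eq = [] , t , eq , []-properSuffix c₀
    suffix-of-ext c₀ (y ∷ s) e []      ()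
    suffix-of-ext c₀ (y ∷ s) e (c ∷ t) eq with ++-≡-++-split (y ∷ s) e (φ c) (φ* t) eq
    ... | inj₁ (s′ , _ , s′++e≡)   = suffix-of-ext c₀ s′ e t (sym s′++e≡)
    ... | inj₂ (x , _ , φc≡ , e≡) = x , t , e≡ , c , y ∷ s , (λ ()) , sym φc≡

    circular-of-ext : ∀ t → t ≢ [] → Circular (φ* t)
    circular-of-ext t t≢[] with initLast t
    ... | []       = ⊥-elim (t≢[] refl)
    ... | t′ ∷ʳ′ c = record
      { q = [] ; r = φ* t′ ; p = φ c
      ; split    = trans (concatMap-++ φ t′ [ c ]) (cong (φ* t′ ++_) (++-identityʳ (φ c)))
      ; factor   = t′ , refl
      ; image    = c , ++-identityʳ (φ c)
      ; nonempty = φ≢[] c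
      }

    rotation-circular : ∀ {d s} u → d ++ s ≡ φ* u → s ≢ [] → Circular (s ++ d)
    rotation-circular {d} {s} u eq s≢[] with ext-cut d s u eq s≢[]
    ... | cut v₁ v₂ c [] b b≡φc _ refl refl =
          subst Circular rotated (circular-of-ext (c ∷ v₂ ++ v₁) (λ ()))
      where
      rotated : φ* (c ∷ v₂ ++ v₁) ≡ (b ++ φ* v₂) ++ φ* v₁ ++ []
      rotated = begin
        φ c ++ φ* (v₂ ++ v₁)         ≡⟨ cong₂ _++_ (sym b≡φc) (concatMap-++ φ v₂ v₁) ⟩
        b ++ φ* v₂ ++ φ* v₁          ≡⟨ solve (++-monoid (Fin k)) ⟩
        (b ++ φ* v₂) ++ φ* v₁ ++ []  ∎
    ... | cut v₁ v₂ c (a₀ ∷ a) b a++b≡φc _ refl refl = record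
      { q = b ; r = φ* (v₂ ++ v₁) ; p = a₀ ∷ a
      ; split    = begin
          (b ++ φ* v₂) ++ φ* v₁ ++ a₀ ∷ a   ≡⟨ solve (++-monoid (Fin k)) ⟩
          b ++ (φ* v₂ ++ φ* v₁) ++ a₀ ∷ a   ≡⟨ cong (λ r → b ++ r ++ a₀ ∷ a) (concatMap-++ φ v₂ v₁) ⟨
          b ++ φ* (v₂ ++ v₁) ++ a₀ ∷ a      ∎
      ; factor   = v₂ ++ v₁ , refl
      ; image    = c , a++b≡φc
      ; nonempty = λ ()
      }

  module _ (inj : Injective φ) (noIF : ∀ c → ¬ HasInterferedImageFactorization φ (φ* [ c ])) where

    private
      φ≢[] : ∀ c → φ c ≢ []
      φ≢[] = injective⇒nonerasing inj

    image-rigid : ∀ c x w z → ProperSuffixOfImage φ x → ProperPrefixOfImage φ z →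
                  φ c ≡ x ++ φ* w ++ z → x ≡ [] × z ≡ [] × w ≡ [ c ]
    image-rigid c [] w [] _ _ eq = refl , refl , inj w [ c ] (begin
      φ* w        ≡⟨ ++-identityʳ (φ* w) ⟨
      φ* w ++ []  ≡⟨ eq ⟨
      φ c         ≡⟨ ++-identityʳ (φ c) ⟨
      φ c ++ []   ∎)
    image-rigid c x@(_ ∷ _) w z sx pz eq =
      ⊥-elim (noIF c (x , φ* w , z , trans (++-identityʳ (φ c)) eq , sx , (w , refl) , pz , λ ()))
    image-rigid c [] w z@(_ ∷ _) sx pz eq =
      ⊥-elim (noIF c ([] , φ* w , z , trans (++-identityʳ (φ c)) eq , sx , (w , refl) , pz , λ ()))

    circular-aligned : ∀ {v₁ c₁ c₂} q₁ p₁ d r₂ p₂ →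
      φ* v₁ ++ p₁ ≡ d ++ r₂ ++ p₂ → p₁ ++ q₁ ≡ φ c₁ → p₂ ++ q₁ ++ d ≡ φ c₂ → p₂ ≢ [] →
      d ≡ [] × p₁ ≡ p₂
    circular-aligned {v₁} {c₁} {c₂} q₁ p₁ d r₂ p₂ rp φc₁ φc₂ p₂≢[]
      with ext-cut d (r₂ ++ p₂ ++ q₁) (v₁ ++ [ c₁ ]) d-prefix rest≢[]
         | ++-≡-++-split (φ* v₁) p₁ (d ++ r₂) p₂ (trans rp (sym (++-assoc d r₂ p₂)))
      where
      d-prefix : d ++ r₂ ++ p₂ ++ q₁ ≡ φ* (v₁ ++ [ c₁ ])
      d-prefix = begin
        d ++ r₂ ++ p₂ ++ q₁        ≡⟨ solve (++-monoid (Fin k)) ⟩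
        (d ++ r₂ ++ p₂) ++ q₁      ≡⟨ cong (_++ q₁) rp ⟨
        (φ* v₁ ++ p₁) ++ q₁        ≡⟨ ++-assoc (φ* v₁) p₁ q₁ ⟩
        φ* v₁ ++ p₁ ++ q₁          ≡⟨ cong (φ* v₁ ++_) (trans φc₁ (sym (++-identityʳ (φ c₁)))) ⟩
        φ* v₁ ++ φ* [ c₁ ]         ≡⟨ concatMap-++ φ v₁ [ c₁ ] ⟨
        φ* (v₁ ++ [ c₁ ])          ∎
      rest≢[] : r₂ ++ p₂ ++ q₁ ≢ []
      rest≢[] eq = p₂≢[] (++-conicalˡ p₂ q₁ (++-conicalʳ r₂ _ eq))
    ... | cut w′ _ c z′ b z′++b≡ b≢[] refl _ | inj₁ (e , φv₁≡ , refl)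
      with suffix-of-ext φ≢[] c₁ (d ++ r₂) e v₁ (sym φv₁≡)
    ... | x , w , refl , sx
      with image-rigid c₂ x (w ++ c₁ ∷ w′) z′ sx (c , b , b≢[] , z′++b≡) φc₂≡
      where
      φc₂≡ : φ c₂ ≡ x ++ φ* (w ++ c₁ ∷ w′) ++ z′
      φc₂≡ = begin
        φ c₂                                          ≡⟨ φc₂ ⟨
        ((x ++ φ* w) ++ p₁) ++ q₁ ++ φ* w′ ++ z′      ≡⟨ solve (++-monoid (Fin k)) ⟩
        x ++ (φ* w ++ (p₁ ++ q₁) ++ φ* w′) ++ z′      ≡⟨ cong (λ t → x ++ (φ* w ++ t ++ φ* w′) ++ z′) φc₁ ⟩
        x ++ (φ* w ++ φ c₁ ++ φ* w′) ++ z′            ≡⟨ cong (λ t → x ++ t ++ z′) (concatMap-++ φ w (c₁ ∷ w′)) ⟨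
        x ++ φ* (w ++ c₁ ∷ w′) ++ z′                  ∎
    ... | refl , refl , w++c₁∷w′≡ with ++-∷-≡-[-] w w++c₁∷w′≡
    ... | refl , refl = refl , refl
    circular-aligned {c₁ = c₁} {c₂} q₁ p₁ _ r₂ p₂ rp φc₁ φc₂ p₂≢[]
      | cut w′ _ c z′ b z′++b≡ b≢[] refl _ | inj₂ (e , e≢[] , _ , refl)
      with image-rigid c₂ (p₂ ++ q₁) w′ z′
             (c₁ , e , e≢[] , trans (sym (++-assoc e p₂ q₁)) φc₁) (c , b , b≢[] , z′++b≡)
             (trans (sym φc₂) (sym (++-assoc p₂ q₁ _)))
    ... | p₂++q₁≡[] , _ = ⊥-elim (p₂≢[] (++-conicalˡ p₂ q₁ p₂++q₁≡[]))

    circular-unique-≤ : ∀ {W d} (f g : Circular W) → q g ≡ q f ++ d → r f ++ p f ≡ d ++ r g ++ p g →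
                        q f ≡ q g × r f ≡ r g × p f ≡ p g
    circular-unique-≤ {d = d} f g q≡ rp≡ with factor f | image f | image g
    ... | v₁ , refl | c₁ , φc₁ | c₂ , φc₂
      with circular-aligned {v₁} {c₁} {c₂} (q f) (p f) d (r g) (p g) rp≡ φc₁
             (trans (cong (p g ++_) (sym q≡)) φc₂) (nonempty g)
    ... | refl , p≡ =
      sym (trans q≡ (++-identityʳ (q f))) ,
      ++-cancelʳ (p f) _ _ (subst (λ t → r f ++ p f ≡ r g ++ t) (sym p≡) rp≡) ,
      p≡

    circular-unique : ∀ {W} (f g : Circular W) → q f ≡ q g × r f ≡ r g × p f ≡ p g
    circular-unique f g
      with ++-≡-++-split (q f) (r f ++ p f) (q g) (r g ++ p g) (trans (sym (split f)) (split g))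
    ... | inj₁ (_ , q₁≡ , rp₂≡) = let qe , re , pe = circular-unique-≤ g f q₁≡ rp₂≡ in sym qe , sym re , sym pe
    ... | inj₂ (_ , _ , q₂≡ , rp₁≡) = circular-unique-≤ f g q₂≡ rp₁≡

-- Only the letter-image case of the interference clause is needed.
corollary21 : ∀ {m k : ℕ} (φ : Morphism m k) → StronglyInterferenceFree φ → Recognizable φ
corollary21 φ (inj , sif) = inj , λ where
  u _ _ (zero , () , _)
  u _ _ (suc i , _ , i<∣φ*u∣ , refl) →
      rotation-circular φ (injective⇒nonerasing φ inj) u (take++drop≡id i (ext φ u)) (drop-≢[] i (ext φ u) i<∣φ*u∣)
    , circular-unique φ inj (λ c → proj₁ (sif [ c ] λ ()))
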